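{- Let $(L;\wedge,\vee,^{\Delta},^{\nabla},0,1)$ be a weakly dicomplemented lattice and let $F$ be a filter of $L$. The following are equivalent: ($\dagger$) for all $x,y\in F$, $x\,\overline{\sqcap}\,y\in F$; ($\ddagger$) there exists a filter $G$ of $\overline{S}(L)$ such that $F=\{x\in L\mid x^{\Delta\Delta}\in G\}$; ($\dagger\ddagger$) there exists a filter $G$ of $\overline{S}(L)$ such that $F=\{x\in L\mid \exists u\in G,\ u\le x\}$.
   Context: A weakly dicomplemented lattice (WDL) is an algebra $(L;\wedge,\vee,^{\Delta},^{\nabla},0,1)$ such that $(L;\wedge,\vee,0,1)$ is a bounded lattice and, for all $x,y\in L$: $x^{\Delta\Delta}\le x$; $x\le y\Rightarrow y^{\Delta}\le x^{\Delta}$; $(x\wedge y)\vee(x\wedge y^{\Delta})=x$; $x^{\nabla\nabla}\ge x$; $x\le y\Rightarrow y^{\nabla}\le x^{\nabla}$; $(x\vee y)\wedge(x\vee y^{\nabla})=x$. A filter of $L$ is a nonempty upward closed subset closed under $\wedge$. $\overline{S}(L)=\{x\in L\mid x^{\Delta\Delta}=x\}$, $x\,\overline{\sqcap}\,y=(x^{\Delta}\vee y^{\Delta})^{\Delta}$; $(\overline{S}(L);\overline{\sqcap},\vee,^{\Delta},0,1)$ is an ortholattice, and a filter of $\overline{S}(L)$ is a nonempty subset of $\overline{S}(L)$ upward closed within $\overline{S}(L)$ and closed under $\overline{\sqcap}$. -}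

module Defs where

open import Level using (Level; _⊔_; suc)
open import Data.Product using (_×_; ∃; Σ-syntax)
open import Function.Bundles using (_⇔_)
open import Algebra.Lattice.Bundles using (Lattice)

record WDL (c ℓ : Level) : Set (suc (c ⊔ ℓ)) where
  field
    lattice : Lattice c ℓ
  open Lattice lattice public
  infix 4 _≤_
  _≤_ : Carrier → Carrier → Set ℓ
  x ≤ y = (x ∧ y) ≈ x
  field
    ⊥ ⊤ : Carrier
    ⊥-min : ∀ x → ⊥ ≤ x
    ⊤-max : ∀ x → x ≤ ⊤
    Δ ∇ : Carrier → Carrier
    ΔΔ-≤ : ∀ x → Δ (Δ x) ≤ x
    Δ-antitone : ∀ x y → x ≤ y → Δ y ≤ Δ x
    Δ-law : ∀ x y → ((x ∧ y) ∨ (x ∧ Δ y)) ≈ x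
    ∇∇-≥ : ∀ x → x ≤ ∇ (∇ x)
    ∇-antitone : ∀ x y → x ≤ y → ∇ y ≤ ∇ x
    ∇-law : ∀ x y → ((x ∨ y) ∧ (x ∨ ∇ y)) ≈ x

  S̄ : Carrier → Set ℓ
  S̄ x = Δ (Δ x) ≈ x

  _⊓̄_ : Carrier → Carrier → Carrier
  x ⊓̄ y = Δ (Δ x ∨ Δ y)

  record IsFilter {p : Level} (F : Carrier → Set p) : Set (c ⊔ ℓ ⊔ p) where
    field
      nonempty : ∃ F
      up-closed : ∀ x y → F x → x ≤ y → F y
      ∧-closed : ∀ x y → F x → F y → F (x ∧ y)

  record IsS̄Filter {p : Level} (G : Carrier → Set p) : Set (c ⊔ ℓ ⊔ p) where
    field
      ⊆S̄ : ∀ x → G x → S̄ x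
      nonempty : ∃ G
      up-closed : ∀ x y → G x → S̄ y → x ≤ y → G y
      ⊓̄-closed : ∀ x y → G x → G y → G (x ⊓̄ y)

{-# OPTIONS --safe #-}
module Submission where

open import Defs
open import Level using (_⊔_)
open import Data.Product using (_×_; Σ-syntax; _,_; proj₂; map₂)
open import Function.Bundles using (_⇔_; mk⇔; module Equivalence)
open import Function.Construct.Composition using (_⇔-∘_)
open import Function.Construct.Symmetry using (⇔-sym)
open import Relation.Unary using (Pred; _∩_)

-- The maps x ↦ xΔΔ and x ↦ x ⊓̄ x agree, and xΔΔ is the largest
-- element of S̄(L) below x.  Hence a filter G of S̄(L) contains xΔΔ exactly
-- when it contains some u ≤ x, which identifies (‡) with (†‡); if F is
-- ⊓̄-closed then F ∩ S̄(L) is such a G, and conversely a ΔΔ-preimage of a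
-- ⊓̄-closed G is ⊓̄-closed since x ⊓̄ y only depends on xΔΔ and yΔΔ.
module WDLProperties {c ℓ} (L : WDL c ℓ) where
  open WDL L
  open Equivalence
  open import Algebra.Lattice.Properties.Lattice lattice using (∧-idem; ∨-idem)

  ≤-reflexive : ∀ {x y} → x ≈ y → x ≤ y
  ≤-reflexive {x} x≈y = trans (∧-cong refl (sym x≈y)) (∧-idem x)

  ≤-trans : ∀ {x y z} → x ≤ y → y ≤ z → x ≤ z
  ≤-trans {x} {y} {z} x≤y y≤z =
    trans (∧-cong (sym x≤y) refl) (trans (∧-assoc x y z) (trans (∧-cong refl y≤z) x≤y))

  ≤-antisym : ∀ {x y} → x ≤ y → y ≤ x → x ≈ y
  ≤-antisym {x} {y} x≤y y≤x = trans (sym x≤y) (trans (∧-comm x y) y≤x)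

  Δ-cong : ∀ {x y} → x ≈ y → Δ x ≈ Δ y
  Δ-cong {x} {y} x≈y =
    ≤-antisym (Δ-antitone y x (≤-reflexive (sym x≈y))) (Δ-antitone x y (≤-reflexive x≈y))

  ΔΔ-monotone : ∀ {x y} → x ≤ y → Δ (Δ x) ≤ Δ (Δ y)
  ΔΔ-monotone {x} {y} x≤y = Δ-antitone _ _ (Δ-antitone x y x≤y)

  S̄-Δ : ∀ x → S̄ (Δ x)
  S̄-Δ x = ≤-antisym (ΔΔ-≤ (Δ x)) (Δ-antitone _ _ (ΔΔ-≤ x))

  ⊓̄-idem : ∀ x → x ⊓̄ x ≈ Δ (Δ x)
  ⊓̄-idem x = Δ-cong (∨-idem (Δ x))

  ⊓̄-ΔΔ : ∀ x y → Δ (Δ x) ⊓̄ Δ (Δ y) ≈ x ⊓̄ y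
  ⊓̄-ΔΔ x y = Δ-cong (∨-cong (S̄-Δ x) (S̄-Δ y))

  ⊓̄-Closed : ∀ {p} → Pred Carrier p → Set (c ⊔ p)
  ⊓̄-Closed F = ∀ x y → F x → F y → F (x ⊓̄ y)

  _IsΔΔ-PreimageOf_ : ∀ {p q} → Pred Carrier p → Pred Carrier q → Set (c ⊔ p ⊔ q)
  F IsΔΔ-PreimageOf G = ∀ x → F x ⇔ G (Δ (Δ x))

  _IsUpsetGeneratedBy_ : ∀ {p q} → Pred Carrier p → Pred Carrier q → Set (c ⊔ ℓ ⊔ p ⊔ q)
  F IsUpsetGeneratedBy G = ∀ x → F x ⇔ (Σ[ u ∈ Carrier ] (G u × u ≤ x))

  module _ {q} {G : Pred Carrier q} (G-filter : IsS̄Filter G) where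
    open IsS̄Filter G-filter

    ΔΔ-∈⇔bounded-below : ∀ x → G (Δ (Δ x)) ⇔ (Σ[ u ∈ Carrier ] (G u × u ≤ x))
    ΔΔ-∈⇔bounded-below x = mk⇔
      (λ ΔΔx∈G → Δ (Δ x) , ΔΔx∈G , ΔΔ-≤ x)
      (λ { (u , u∈G , u≤x) → up-closed u _ u∈G (S̄-Δ (Δ x))
             (≤-trans (≤-reflexive (sym (⊆S̄ u u∈G))) (ΔΔ-monotone u≤x)) })

    ΔΔ-preimage⇔upset-generated : ∀ {p} {F : Pred Carrier p} →
      F IsΔΔ-PreimageOf G ⇔ F IsUpsetGeneratedBy G
    ΔΔ-preimage⇔upset-generated = mk⇔
      (λ preimage x → ΔΔ-∈⇔bounded-below x ⇔-∘ preimage x)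
      (λ upset x → ⇔-sym (ΔΔ-∈⇔bounded-below x) ⇔-∘ upset x)

    ΔΔ-preimage⇒⊓̄-closed : ∀ {p} {F : Pred Carrier p} →
      F IsΔΔ-PreimageOf G → ⊓̄-Closed F
    ΔΔ-preimage⇒⊓̄-closed preimage x y x∈F y∈F =
      from (preimage (x ⊓̄ y)) (from (ΔΔ-∈⇔bounded-below (x ⊓̄ y))
        (_ , ⊓̄-closed _ _ (to (preimage x) x∈F) (to (preimage y) y∈F) , ≤-reflexive (⊓̄-ΔΔ x y)))

  module _ {p} {F : Pred Carrier p} (F-filter : IsFilter F) (F-⊓̄-closed : ⊓̄-Closed F) where
    open IsFilter F-filter

    ⊓̄-closed⇒∩S̄-isS̄Filter : IsS̄Filter (F ∩ S̄)
    ⊓̄-closed⇒∩S̄-isS̄Filter = record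
      { ⊆S̄ = λ _ → proj₂
      ; nonempty = let a , a∈F = nonempty in a ⊓̄ a , F-⊓̄-closed a a a∈F a∈F , S̄-Δ _
      ; up-closed = λ x y (x∈F , _) S̄y x≤y → up-closed x y x∈F x≤y , S̄y
      ; ⊓̄-closed = λ x y (x∈F , _) (y∈F , _) → F-⊓̄-closed x y x∈F y∈F , S̄-Δ _
      }

    ⊓̄-closed⇒ΔΔ-preimage-of-∩S̄ : F IsΔΔ-PreimageOf (F ∩ S̄)
    ⊓̄-closed⇒ΔΔ-preimage-of-∩S̄ x = mk⇔
      (λ x∈F → up-closed _ _ (F-⊓̄-closed x x x∈F x∈F) (≤-reflexive (⊓̄-idem x)) , S̄-Δ (Δ x))
      (λ (ΔΔx∈F , _) → up-closed _ _ ΔΔx∈F (ΔΔ-≤ x))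

proposition4p2 : ∀ {c ℓ} (L : WDL c ℓ) → let open WDL L in
    (F : Carrier → Set ℓ) → IsFilter F →
    ((∀ x y → F x → F y → F (x ⊓̄ y))
      ⇔ (Σ[ G ∈ (Carrier → Set ℓ) ] (IsS̄Filter G × (∀ x → F x ⇔ G (Δ (Δ x))))))
    × ((Σ[ G ∈ (Carrier → Set ℓ) ] (IsS̄Filter G × (∀ x → F x ⇔ G (Δ (Δ x)))))
      ⇔ (Σ[ G ∈ (Carrier → Set ℓ) ] (IsS̄Filter G × (∀ x → F x ⇔ (Σ[ u ∈ Carrier ] (G u × u ≤ x))))))
proposition4p2 L F F-filter =
  mk⇔ (λ F-⊓̄-closed → F ∩ S̄ , ⊓̄-closed⇒∩S̄-isS̄Filter F-filter F-⊓̄-closed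
                             , ⊓̄-closed⇒ΔΔ-preimage-of-∩S̄ F-filter F-⊓̄-closed)
      (λ (_ , G-filter , preimage) → ΔΔ-preimage⇒⊓̄-closed G-filter preimage)
  , mk⇔ (map₂ λ (G-filter , preimage) → G-filter , to (ΔΔ-preimage⇔upset-generated G-filter) preimage)
        (map₂ λ (G-filter , upset) → G-filter , from (ΔΔ-preimage⇔upset-generated G-filter) upset)
  where
  open WDL L
  open WDLProperties L
  open Equivalence
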